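{- Let $n\geq 0$ be an integer, $[n]=\{1,\dots,n\}$, $\mathbf{k}$ a commutative ring and $\mathcal{A}=\mathbf{k}[S_n]$. Let $A,B,C,D\subseteq[n]$ with $|A|=|B|$ and $|C|=|D|$. Then: (a) $\nabla_{D,C}\nabla_{B,A}=\omega_{B,C}\sum_{w\in S_n,\ |w(A)\cap D|=|B\cap C|} w$; (b) $\nabla_{D,C}\nabla_{B,A}=\omega_{B,C}\sum_{U\subseteq D,\ V\subseteq A,\ |U|=|V|}(-1)^{|U|-|B\cap C|}\binom{|U|}{|B\cap C|}\nabla_{U,V}$; (c) $\nabla_{D,C}\nabla_{B,A}=\omega_{B,C}\sum_{V\subseteq A}(-1)^{|V|-|B\cap C|}\binom{|V|}{|B\cap C|}\widetilde{\nabla}_{D,V}$.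
   Context: $S_n$ is the symmetric group of permutations of $[n]$ and $\mathcal{A}=\mathbf{k}[S_n]$ its group algebra. For subsets $X,Y\subseteq[n]$ define $\nabla_{Y,X}:=\sum_{w\in S_n,\ w(X)=Y} w\in\mathcal{A}$ and $\widetilde{\nabla}_{Y,X}:=\sum_{w\in S_n,\ w(X)\subseteq Y} w\in\mathcal{A}$. For $B,C\subseteq[n]$ define the positive integer $\omega_{B,C}:=|B\cap C|!\cdot|B\setminus C|!\cdot|C\setminus B|!\cdot|[n]\setminus(B\cup C)|!$. -}

module Defs where

open import Level using (Level)
open import Data.Bool using (Bool; true; false; _∧_; _∨_; not; if_then_else_; T)
open import Data.Nat as ℕ using (ℕ; zero; suc; _∸_)
import Data.Nat.Properties as ℕP
open import Data.Nat.Combinatorics using (_C_)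
open import Data.Nat using (_!)
open import Data.Fin using (Fin; zero; suc)
import Data.Fin.Properties as FinP
open import Data.Fin.Subset using (Subset; _∩_; _─_; _∪_; ∁; ∣_∣)
open import Data.Vec using (Vec; []; _∷_; lookup; tabulate)
import Data.Vec.Properties as VecP
open import Data.List using (List; []; _∷_; map; concatMap; filter; foldr)
open import Relation.Nullary.Decidable using (⌊_⌋)
open import Algebra.Bundles using (CommutativeRing)

anyF : ∀ {m} → (Fin m → Bool) → Bool
anyF {zero}  p = false
anyF {suc m} p = p zero ∨ anyF (λ i → p (suc i))

allF : ∀ {m} → (Fin m → Bool) → Bool
allF {zero}  p = true
allF {suc m} p = p zero ∧ allF (λ i → p (suc i))

_==F_ : ∀ {m} → Fin m → Fin m → Bool
i ==F j = ⌊ i FinP.≟ j ⌋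

_==ℕ_ : ℕ → ℕ → Bool
a ==ℕ b = ⌊ a ℕP.≟ b ⌋

-- Permutations of [n] = Fin n, represented by their value table
-- w = (w(0), …, w(n-1)).  A word is a permutation iff it is injective.

Word : ℕ → Set
Word n = Vec (Fin n) n

isPerm : ∀ {n} → Word n → Bool
isPerm w = allF λ i → allF λ j → not (lookup w i ==F lookup w j) ∨ (i ==F j)

vecs : (n m : ℕ) → List (Vec (Fin n) m)
vecs n zero    = [] ∷ []
vecs n (suc m) = concatMap (λ v → map (λ i → i ∷ v) (allFinL n)) (vecs n m)
  where
  allFinL : (k : ℕ) → List (Fin k)
  allFinL zero    = []
  allFinL (suc k) = zero ∷ map suc (allFinL k)

Sym : (n : ℕ) → List (Word n)
Sym n = filter (λ w → T? (isPerm w)) (vecs n n)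
  where
  open import Relation.Nullary.Decidable using (T?)

_∘ₚ_ : ∀ {n} → Word n → Word n → Word n
u ∘ₚ v = tabulate λ i → lookup u (lookup v i)

_==W_ : ∀ {n} → Word n → Word n → Bool
u ==W v = ⌊ VecP.≡-dec FinP._≟_ u v ⌋

image : ∀ {n} → Word n → Subset n → Subset n
image w X = tabulate λ j → anyF λ i → lookup X i ∧ (lookup w i ==F j)

_==S_ : ∀ {n} → Subset n → Subset n → Bool
X ==S Y = ⌊ VecP.≡-dec Data.Bool._≟_ X Y ⌋
  where import Data.Bool

_⊆ᵇ_ : ∀ {n} → Subset n → Subset n → Bool
X ⊆ᵇ Y = allF λ i → not (lookup X i) ∨ lookup Y i

subsets : (n : ℕ) → List (Subset n)
subsets zero    = [] ∷ []
subsets (suc n) = concatMap (λ s → (true ∷ s) ∷ (false ∷ s) ∷ []) (subsets n)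

ω : ∀ {n} → Subset n → Subset n → ℕ
ω B C = (∣ B ∩ C ∣ !) ℕ.* (∣ B ─ C ∣ !) ℕ.* (∣ C ─ B ∣ !) ℕ.* (∣ ∁ (B ∪ C) ∣ !)

-- The group algebra k[S_n] over a commutative ring k.  An element is
-- given by its coefficient function; only the values at permutations
-- (words w with T (isPerm w)) are meaningful.

module GroupAlgebra {c ℓ} (R : CommutativeRing c ℓ) (n : ℕ) where
  open CommutativeRing R

  𝒜 : Set c
  𝒜 = Word n → Carrier

  _≋_ : 𝒜 → 𝒜 → Set ℓ
  f ≋ g = ∀ w → T (isPerm w) → f w ≈ g w

  ΣL : ∀ {a} {X : Set a} → List X → (X → Carrier) → Carrier
  ΣL xs f = foldr (λ x r → f x + r) 0# xs

  ind : Bool → Carrier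
  ind b = if b then 1# else 0#

  ι : ℕ → Carrier
  ι zero    = 0#
  ι (suc m) = 1# + ι m

  sgn : ℕ → Carrier
  sgn zero    = 1#
  sgn (suc m) = - (sgn m)

  _·_ : Carrier → 𝒜 → 𝒜
  (a · f) w = a * f w

  0𝒜 : 𝒜
  0𝒜 w = 0#

  _⊕_ : 𝒜 → 𝒜 → 𝒜
  (f ⊕ g) w = f w + g w

  Σ𝒜 : ∀ {a} {X : Set a} → List X → (X → 𝒜) → 𝒜
  Σ𝒜 xs f = foldr (λ x r → f x ⊕ r) 0𝒜 xs

  _⊛_ : 𝒜 → 𝒜 → 𝒜
  (f ⊛ g) w = ΣL (Sym n) λ u → ΣL (Sym n) λ v →
                 ind ((u ∘ₚ v) ==W w) * (f u * g v)

  ∇ : Subset n → Subset n → 𝒜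
  ∇ Y X w = ind (image w X ==S Y)

  ∇̃ : Subset n → Subset n → 𝒜
  ∇̃ Y X w = ind (image w X ⊆ᵇ Y)

module Submission where

-- For a permutation w, the coefficient of w in ∇_{D,C} ∇_{B,A} is the number of permutations u with
-- u(C) = D and u(B) = w(A), the other factor being forced to be u⁻¹w. These u are the bijections
-- carrying each of the four cells of the Venn diagram of (B, C) onto the corresponding cell of
-- (w(A), D), counted by a product of falling factorials. As |A| = |B| and |C| = |D|, matching cells
-- all have equal sizes when |w(A) ∩ D| = |B ∩ C|, giving ω_{B,C}; otherwise some cell of (B, C) is
-- too large and there are none. Parts (b) and (c) follow from (a) by the alternating binomial identity
-- ∑_{V ⊆ E} (-1)^{|V|-k} (|V| choose k) = [|E| = k] for E = A ∩ w⁻¹(D), a set of size |w(A) ∩ D|.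

open import Defs
open import Function using (_∘_)
open import Function.Definitions using (Injective)
open import Data.Bool as Bool using (Bool; true; false; _∧_; _∨_; not; T)
open import Data.Nat as ℕ using (ℕ; zero; suc; _∸_; _≤_; _<_; z≤n; s≤s; _!)
import Data.Nat.Properties as ℕP
import Data.Nat.Combinatorics as Comb
open import Data.Fin using (Fin; zero; suc)
import Data.Fin.Properties as FinP
open import Data.Fin.Subset using (Subset; _∩_; _─_; _∪_; ∁; ∣_∣)
open import Data.Vec using (Vec; []; _∷_; lookup; tabulate)
import Data.Vec.Properties as VecP
open import Data.List using (List; []; _∷_; _++_; map; concatMap; filter; foldr)
open import Data.Product using (_×_; _,_; proj₁; proj₂; ∃-syntax)
open import Data.Sum using (_⊎_; inj₁; inj₂)
open import Data.Empty using (⊥-elim)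
open import Data.Unit using (tt)
open import Relation.Nullary using (¬_; yes; no)
open import Relation.Binary using (tri<; tri≈; tri>)
open import Relation.Nullary.Decidable using (⌊_⌋; toWitness; fromWitness)
open import Relation.Binary.PropositionalEquality as ≡
  using (_≡_; _≢_; cong; cong₂; subst; module ≡-Reasoning)
open import Algebra.Bundles using (CommutativeRing; CommutativeSemiring)

fins : ∀ n → List (Fin n)
fins zero    = []
fins (suc n) = zero ∷ map suc (fins n)

-- vecs enumerates Fin n by a where-bound list that cannot be named;
-- it is recovered from the unfolding of vecs n 1.
private
  vecs-one : ∀ n → ∃[ is ] vecs n 1 ≡ concatMap (λ v → map (_∷ v) is) ([] ∷ [])
  vecs-one n = _ , ≡.refl

  vecs-one≡fins : ∀ n → proj₁ (vecs-one n) ≡ fins n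
  vecs-one≡fins zero    = ≡.refl
  vecs-one≡fins (suc n) = cong (λ is → zero ∷ map suc is) (vecs-one≡fins n)

vecs-suc : ∀ n m → vecs n (suc m) ≡ concatMap (λ v → map (_∷ v) (fins n)) (vecs n m)
vecs-suc n m = cong (λ is → concatMap (λ v → map (_∷ v) is) (vecs n m)) (vecs-one≡fins n)

module ListSum {c ℓ} (S : CommutativeSemiring c ℓ) where
  open CommutativeSemiring S renaming (refl to ≈-refl; sym to ≈-sym; trans to ≈-trans)
  open import Relation.Binary.Reasoning.Setoid setoid
  open import Algebra.Properties.CommutativeSemigroup +-commutativeSemigroup using (x∙yz≈y∙xz)

  ∑ : ∀ {a} {X : Set a} → List X → (X → Carrier) → Carrier
  ∑ xs f = foldr (λ x r → f x + r) 0# xs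

  ∑-cong : ∀ {a} {X : Set a} (xs : List X) {f g : X → Carrier} → (∀ x → f x ≈ g x) → ∑ xs f ≈ ∑ xs g
  ∑-cong []       _ = ≈-refl
  ∑-cong (x ∷ xs) e = +-cong (e x) (∑-cong xs e)

  ∑-++ : ∀ {a} {X : Set a} (xs ys : List X) (f : X → Carrier) → ∑ (xs ++ ys) f ≈ ∑ xs f + ∑ ys f
  ∑-++ []       ys f = ≈-sym (+-identityˡ _)
  ∑-++ (x ∷ xs) ys f = ≈-trans (+-congˡ (∑-++ xs ys f)) (≈-sym (+-assoc _ _ _))

  ∑-concatMap : ∀ {a b} {X : Set a} {Y : Set b} (g : X → List Y) (xs : List X) (f : Y → Carrier) →
                ∑ (concatMap g xs) f ≈ ∑ xs (λ x → ∑ (g x) f)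
  ∑-concatMap g []       f = ≈-refl
  ∑-concatMap g (x ∷ xs) f = ≈-trans (∑-++ (g x) (concatMap g xs) f) (+-congˡ (∑-concatMap g xs f))

  ∑-map : ∀ {a b} {X : Set a} {Y : Set b} (g : X → Y) (xs : List X) (f : Y → Carrier) →
          ∑ (map g xs) f ≡ ∑ xs (f ∘ g)
  ∑-map g []       f = ≡.refl
  ∑-map g (x ∷ xs) f = ≡.cong (f (g x) +_) (∑-map g xs f)

  ∑-zero : ∀ {a} {X : Set a} (xs : List X) {f : X → Carrier} → (∀ x → f x ≈ 0#) → ∑ xs f ≈ 0#
  ∑-zero []       _ = ≈-refl
  ∑-zero (x ∷ xs) e = ≈-trans (+-cong (e x) (∑-zero xs e)) (+-identityˡ 0#)

  ∑-*ˡ : ∀ {a} {X : Set a} (xs : List X) (k : Carrier) (f : X → Carrier) → k * ∑ xs f ≈ ∑ xs (λ x → k * f x)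
  ∑-*ˡ []       k f = zeroʳ k
  ∑-*ˡ (x ∷ xs) k f = ≈-trans (distribˡ k _ _) (+-congˡ (∑-*ˡ xs k f))

  ∑-*ʳ : ∀ {a} {X : Set a} (xs : List X) (k : Carrier) (f : X → Carrier) → ∑ xs f * k ≈ ∑ xs (λ x → f x * k)
  ∑-*ʳ xs k f = ≈-trans (*-comm _ k) (≈-trans (∑-*ˡ xs k f) (∑-cong xs (λ x → *-comm k (f x))))

  ∑-+ : ∀ {a} {X : Set a} (xs : List X) (f g : X → Carrier) → ∑ xs (λ x → f x + g x) ≈ ∑ xs f + ∑ xs g
  ∑-+ []       f g = ≈-sym (+-identityˡ 0#)
  ∑-+ (x ∷ xs) f g = begin
    (f x + g x) + ∑ xs (λ x → f x + g x) ≈⟨ +-congˡ (∑-+ xs f g) ⟩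
    (f x + g x) + (∑ xs f + ∑ xs g)      ≈⟨ +-assoc _ _ _ ⟩
    f x + (g x + (∑ xs f + ∑ xs g))      ≈⟨ +-congˡ (x∙yz≈y∙xz _ _ _) ⟩
    f x + (∑ xs f + (g x + ∑ xs g))      ≈⟨ +-assoc _ _ _ ⟨
    (f x + ∑ xs f) + (g x + ∑ xs g)      ∎

  ∑-swap : ∀ {a b} {X : Set a} {Y : Set b} (xs : List X) (ys : List Y) (f : X → Y → Carrier) →
           ∑ xs (λ x → ∑ ys (f x)) ≈ ∑ ys (λ y → ∑ xs (λ x → f x y))
  ∑-swap []       ys f = ≈-sym (∑-zero ys (λ _ → ≈-refl))
  ∑-swap (x ∷ xs) ys f = ≈-trans (+-congˡ (∑-swap xs ys f)) (≈-sym (∑-+ ys (f x) (λ y → ∑ xs (λ x → f x y))))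

  ∑-vecs-suc : ∀ n m (f : Vec (Fin n) (suc m) → Carrier) →
               ∑ (vecs n (suc m)) f ≈ ∑ (vecs n m) (λ v → ∑ (fins n) (λ i → f (i ∷ v)))
  ∑-vecs-suc n m f = begin
    ∑ (vecs n (suc m)) f                                         ≡⟨ ≡.cong (λ vs → ∑ vs f) (vecs-suc n m) ⟩
    ∑ (concatMap (λ v → map (_∷ v) (fins n)) (vecs n m)) f       ≈⟨ ∑-concatMap _ (vecs n m) f ⟩
    ∑ (vecs n m) (λ v → ∑ (map (_∷ v) (fins n)) f)               ≈⟨ ∑-cong (vecs n m) (λ v → reflexive (∑-map (_∷ v) (fins n) f)) ⟩
    ∑ (vecs n m) (λ v → ∑ (fins n) (λ i → f (i ∷ v)))            ∎

  ∑-subsets-suc : ∀ m (f : Subset (suc m) → Carrier) →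
                  ∑ (subsets (suc m)) f ≈ ∑ (subsets m) (λ s → f (true ∷ s) + f (false ∷ s))
  ∑-subsets-suc m f = ≈-trans (∑-concatMap (λ s → (true ∷ s) ∷ (false ∷ s) ∷ []) (subsets m) f)
                              (∑-cong (subsets m) (λ s → +-congˡ (+-identityʳ _)))

module _ where
  open import Data.Nat using (_+_; _*_)
  open ≡ using (refl; sym; trans)
  open import Data.Nat.Tactic.RingSolver using (solve-∀)
  open import Data.Nat.Combinatorics.Base using (_P′_)
  open import Data.Nat.Combinatorics.Specification using (nP′n≡n!)
  import Data.Product.Properties as ×P
  import Data.Bool.Properties as BoolP

  T-ext : ∀ {a b : Bool} → (T a → T b) → (T b → T a) → a ≡ b
  T-ext {true}  {true}  _ _ = refl
  T-ext {true}  {false} f _ = ⊥-elim (f tt)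
  T-ext {false} {true}  _ g = ⊥-elim (g tt)
  T-ext {false} {false} _ _ = refl

  T⇒≡true : ∀ {a} → T a → a ≡ true
  T⇒≡true {true} _ = refl

  ∧-intro : ∀ {a b} → T a → T b → T (a ∧ b)
  ∧-intro {true} {true} _ _ = tt

  ∧-elimˡ : ∀ {a b} → T (a ∧ b) → T a
  ∧-elimˡ {true} _ = tt

  ∧-elimʳ : ∀ {a b} → T (a ∧ b) → T b
  ∧-elimʳ {true} t = t

  ∨-elim : ∀ {a b} → T (a ∨ b) → T a ⊎ T b
  ∨-elim {true}  _ = inj₁ tt
  ∨-elim {false} t = inj₂ t

  ∨-introˡ : ∀ {a b} → T a → T (a ∨ b)
  ∨-introˡ {true} _ = tt

  ∨-introʳ : ∀ {a b} → T b → T (a ∨ b)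
  ∨-introʳ {true}  _ = tt
  ∨-introʳ {false} t = t

  T-not⁺ : ∀ {a} → ¬ T a → T (not a)
  T-not⁺ {true}  f = f tt
  T-not⁺ {false} _ = tt

  T-not⁻ : ∀ {a} → T (not a) → ¬ T a
  T-not⁻ {false} _ ()

  boolToℕ : Bool → ℕ
  boolToℕ true  = 1
  boolToℕ false = 0

  ==F⇒≡ : ∀ {m} {i j : Fin m} → T (i ==F j) → i ≡ j
  ==F⇒≡ = toWitness

  ≡⇒==F : ∀ {m} {i j : Fin m} → i ≡ j → T (i ==F j)
  ≡⇒==F = fromWitness

  ==S⇒≡ : ∀ {m} {X Y : Subset m} → T (X ==S Y) → X ≡ Y
  ==S⇒≡ = toWitness

  ≡⇒==S : ∀ {m} {X Y : Subset m} → X ≡ Y → T (X ==S Y)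
  ≡⇒==S = fromWitness

  ==F-suc : ∀ {m} (i j : Fin m) → (suc i ==F suc j) ≡ (i ==F j)
  ==F-suc i j = T-ext (≡⇒==F ∘ FinP.suc-injective ∘ ==F⇒≡) (≡⇒==F ∘ cong suc ∘ ==F⇒≡)

  ==ℕ-suc : ∀ a b → (suc a ==ℕ suc b) ≡ (a ==ℕ b)
  ==ℕ-suc a b = T-ext (λ t → fromWitness (ℕP.suc-injective (toWitness t)))
                      (λ t → fromWitness (cong suc (toWitness t)))

  ==ℕ-refl : ∀ a → (a ==ℕ a) ≡ true
  ==ℕ-refl a = T⇒≡true (fromWitness {a? = a ℕP.≟ a} refl)

  ==ℕ-≢ : ∀ {a b} → a ≢ b → (a ==ℕ b) ≡ false
  ==ℕ-≢ {a} {b} a≢b with a ℕP.≟ b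
  ... | yes a≡b = ⊥-elim (a≢b a≡b)
  ... | no  _   = refl

  ==S-∷ : ∀ {n} (x y : Bool) (X Y : Subset n) →
          ((x ∷ X) ==S (y ∷ Y)) ≡ (⌊ x Bool.≟ y ⌋ ∧ (X ==S Y))
  ==S-∷ x y X Y = T-ext
    (λ t → let e = toWitness {a? = VecP.≡-dec Bool._≟_ (x ∷ X) (y ∷ Y)} t in
           ∧-intro (fromWitness {a? = x Bool.≟ y} (VecP.∷-injectiveˡ e))
                   (fromWitness {a? = VecP.≡-dec Bool._≟_ X Y} (VecP.∷-injectiveʳ e)))
    (λ t → fromWitness (cong₂ _∷_ (toWitness {a? = x Bool.≟ y} (∧-elimˡ t))
                                  (toWitness {a? = VecP.≡-dec Bool._≟_ X Y} (∧-elimʳ {⌊ x Bool.≟ y ⌋} t))))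

  allF⁻ : ∀ {m} {p : Fin m → Bool} → T (allF p) → ∀ i → T (p i)
  allF⁻ {suc m} {p} t zero    = ∧-elimˡ t
  allF⁻ {suc m} {p} t (suc i) = allF⁻ {m} {p ∘ suc} (∧-elimʳ {p zero} t) i

  allF⁺ : ∀ {m} {p : Fin m → Bool} → (∀ i → T (p i)) → T (allF p)
  allF⁺ {zero}      _ = tt
  allF⁺ {suc m} {p} f = ∧-intro (f zero) (allF⁺ {m} {p ∘ suc} (f ∘ suc))

  anyF⁻ : ∀ {m} {p : Fin m → Bool} → T (anyF p) → ∃[ i ] T (p i)
  anyF⁻ {suc m} {p} t with ∨-elim {p zero} t
  ... | inj₁ t₀ = zero , t₀
  ... | inj₂ t₁ = let (i , tᵢ) = anyF⁻ {m} {p ∘ suc} t₁ in suc i , tᵢ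

  anyF⁺ : ∀ {m} {p : Fin m → Bool} (i : Fin m) → T (p i) → T (anyF p)
  anyF⁺ {suc m} {p} zero    t = ∨-introˡ t
  anyF⁺ {suc m} {p} (suc i) t = ∨-introʳ {p zero} (anyF⁺ {m} {p ∘ suc} i t)

  count : ∀ {m} → (Fin m → Bool) → ℕ
  count {zero}  p = 0
  count {suc m} p = boolToℕ (p zero) + count (p ∘ suc)

  count-cong : ∀ {m} {p q : Fin m → Bool} → (∀ i → p i ≡ q i) → count p ≡ count q
  count-cong {zero}  _ = refl
  count-cong {suc m} e = cong₂ _+_ (cong boolToℕ (e zero)) (count-cong (e ∘ suc))

  count-false : ∀ m → count {m} (λ _ → false) ≡ 0
  count-false zero    = refl
  count-false (suc m) = count-false m

  count-true : ∀ m → count {m} (λ _ → true) ≡ m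
  count-true zero    = refl
  count-true (suc m) = cong suc (count-true m)

  count-≤ : ∀ {m} (p : Fin m → Bool) → count p ≤ m
  count-≤ {zero}  p = z≤n
  count-≤ {suc m} p with p zero
  ... | true  = s≤s (count-≤ (p ∘ suc))
  ... | false = ℕP.m≤n⇒m≤1+n (count-≤ (p ∘ suc))

  count-< : ∀ {m} (p : Fin m → Bool) i → ¬ T (p i) → count p < m
  count-< {suc m} p zero    ¬pi with p zero
  ... | true  = ⊥-elim (¬pi tt)
  ... | false = s≤s (count-≤ (p ∘ suc))
  count-< {suc m} p (suc i) ¬pi with p zero
  ... | true  = s≤s (count-< (p ∘ suc) i ¬pi)
  ... | false = ℕP.m≤n⇒m≤1+n (count-< (p ∘ suc) i ¬pi)

  count≡m⇒all : ∀ {m} (p : Fin m → Bool) → count p ≡ m → ∀ i → T (p i)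
  count≡m⇒all {m} p e i with p i in pi≡
  ... | true  = tt
  ... | false = ⊥-elim (ℕP.<-irrefl e (count-< p i (λ t → subst T pi≡ t)))

  count-∨ : ∀ {m} (p q : Fin m → Bool) → (∀ i → T (p i) → ¬ T (q i)) →
            count (λ i → p i ∨ q i) ≡ count p + count q
  count-∨ {zero}  p q _ = refl
  count-∨ {suc m} p q disjoint with p zero in p₀ | q zero in q₀
  ... | true  | true  = ⊥-elim (disjoint zero (subst T (sym p₀) tt) (subst T (sym q₀) tt))
  ... | true  | false = cong suc (count-∨ (p ∘ suc) (q ∘ suc) (disjoint ∘ suc))
  ... | false | true  = trans (cong suc (count-∨ (p ∘ suc) (q ∘ suc) (disjoint ∘ suc))) (sym (ℕP.+-suc _ _))
  ... | false | false = count-∨ (p ∘ suc) (q ∘ suc) (disjoint ∘ suc)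

  count-split : ∀ {m} (q p : Fin m → Bool) →
                count p ≡ count (λ i → q i ∧ p i) + count (λ i → not (q i) ∧ p i)
  count-split {zero}  q p = refl
  count-split {suc m} q p with q zero | p zero
  ... | true  | true  = cong suc (count-split (q ∘ suc) (p ∘ suc))
  ... | true  | false = count-split (q ∘ suc) (p ∘ suc)
  ... | false | true  = trans (cong suc (count-split (q ∘ suc) (p ∘ suc))) (sym (ℕP.+-suc _ _))
  ... | false | false = count-split (q ∘ suc) (p ∘ suc)

  count-==F : ∀ {m} (a : Fin m) → count (a ==F_) ≡ 1
  count-==F {suc m} zero = cong suc (trans (count-cong zero≠suc) (count-false m))
    where
    zero≠suc : ∀ (i : Fin m) → (zero ==F suc i) ≡ false
    zero≠suc i = T-ext (λ t → FinP.0≢1+n (==F⇒≡ {i = zero} {j = suc i} t)) λ ()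
  count-==F {suc m} (suc a) = trans (count-cong (==F-suc a)) (count-==F a)

  count-∧-==F : ∀ {m} (b : Bool) (a : Fin m) → count (λ j → b ∧ (a ==F j)) ≡ boolToℕ b
  count-∧-==F     true  a = count-==F a
  count-∧-==F {m} false a = count-false m

  lookup-ext : ∀ {a} {A : Set a} {m} (u v : Vec A m) → (∀ i → lookup u i ≡ lookup v i) → u ≡ v
  lookup-ext u v e = trans (sym (VecP.tabulate∘lookup u)) (trans (VecP.tabulate-cong e) (VecP.tabulate∘lookup v))

  ∣∣≡count : ∀ {n} (X : Subset n) → ∣ X ∣ ≡ count (lookup X)
  ∣∣≡count []          = refl
  ∣∣≡count (true ∷ X)  = cong suc (∣∣≡count X)
  ∣∣≡count (false ∷ X) = ∣∣≡count X

  IsInjective : ∀ {n m} → Vec (Fin n) m → Set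
  IsInjective v = Injective _≡_ _≡_ (lookup v)

  isInjective : ∀ {n m} → Vec (Fin n) m → Bool
  isInjective v = allF λ i → allF λ j → not (lookup v i ==F lookup v j) ∨ (i ==F j)

  isInjective⁻ : ∀ {n m} (v : Vec (Fin n) m) → T (isInjective v) → IsInjective v
  isInjective⁻ v t {i} {j} e with ∨-elim {not (lookup v i ==F lookup v j)} (allF⁻ (allF⁻ t i) j)
  ... | inj₁ t′ = ⊥-elim (T-not⁻ t′ (≡⇒==F e))
  ... | inj₂ t′ = ==F⇒≡ t′

  isInjective⁺ : ∀ {n m} (v : Vec (Fin n) m) → IsInjective v → T (isInjective v)
  isInjective⁺ v inj = allF⁺ λ i → allF⁺ λ j → separates i j
    where
    separates : ∀ i j → T (not (lookup v i ==F lookup v j) ∨ (i ==F j))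
    separates i j with lookup v i FinP.≟ lookup v j
    ... | yes e = ≡⇒==F (inj e)
    ... | no  _ = tt

  count-image : ∀ {n m} (v : Vec (Fin n) m) → IsInjective v → (p : Fin m → Bool) →
                count (λ j → anyF (λ i → p i ∧ (lookup v i ==F j))) ≡ count p
  count-image {n} []      _   p = count-false n
  count-image     (a ∷ v) inj p =
    trans (count-∨ (λ j → p zero ∧ (a ==F j)) (λ j → anyF (λ i → p (suc i) ∧ (lookup v i ==F j))) disjoint)
          (cong₂ _+_ (count-∧-==F (p zero) a) (count-image v (FinP.suc-injective ∘ inj) (p ∘ suc)))
    where
    disjoint : ∀ j → T (p zero ∧ (a ==F j)) → ¬ T (anyF (λ i → p (suc i) ∧ (lookup v i ==F j)))
    disjoint j t₀ t₁ =
      let (i , tᵢ) = anyF⁻ {p = λ i → p (suc i) ∧ (lookup v i ==F j)} t₁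
      in FinP.0≢1+n (inj (trans (==F⇒≡ (∧-elimʳ {p zero} t₀)) (sym (==F⇒≡ (∧-elimʳ {p (suc i)} tᵢ)))))

  lookup-image : ∀ {n} (w : Word n) X j → lookup (image w X) j ≡ anyF (λ i → lookup X i ∧ (lookup w i ==F j))
  lookup-image w X j = VecP.lookup∘tabulate _ j

  ∈image⁻ : ∀ {n} (w : Word n) X j → T (lookup (image w X) j) → ∃[ i ] T (lookup X i) × lookup w i ≡ j
  ∈image⁻ w X j t =
    let (i , t′) = anyF⁻ {p = λ i → lookup X i ∧ (lookup w i ==F j)} (subst T (lookup-image w X j) t)
    in i , ∧-elimˡ t′ , ==F⇒≡ (∧-elimʳ {lookup X i} t′)

  ∈image⁺ : ∀ {n} (w : Word n) X i → T (lookup X i) → T (lookup (image w X) (lookup w i))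
  ∈image⁺ w X i t = subst T (sym (lookup-image w X _))
    (anyF⁺ {p = λ i′ → lookup X i′ ∧ (lookup w i′ ==F lookup w i)} i (∧-intro t (≡⇒==F refl)))

  ∣image∣ : ∀ {n} (w : Word n) → IsInjective w → ∀ X → ∣ image w X ∣ ≡ ∣ X ∣
  ∣image∣ w inj X = begin
    ∣ image w X ∣                                                  ≡⟨ ∣∣≡count (image w X) ⟩
    count (lookup (image w X))                                     ≡⟨ count-cong (lookup-image w X) ⟩
    count (λ j → anyF (λ i → lookup X i ∧ (lookup w i ==F j)))     ≡⟨ count-image w inj (lookup X) ⟩
    count (lookup X)                                               ≡⟨ ∣∣≡count X ⟨
    ∣ X ∣                                                          ∎
    where open ≡-Reasoning

  lookup-image-at : ∀ {n} (u : Word n) → IsInjective u → ∀ X i → lookup (image u X) (lookup u i) ≡ lookup X i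
  lookup-image-at u inj X i = T-ext
    (λ t → let (i′ , t′ , e) = ∈image⁻ u X _ t in subst (T ∘ lookup X) (inj e) t′)
    (∈image⁺ u X i)

  image-injective : ∀ {n} (u : Word n) → IsInjective u → ∀ X Y → image u X ≡ image u Y → X ≡ Y
  image-injective u inj X Y e = lookup-ext X Y λ i → begin
    lookup X i                     ≡⟨ lookup-image-at u inj X i ⟨
    lookup (image u X) (lookup u i) ≡⟨ cong (λ Z → lookup Z (lookup u i)) e ⟩
    lookup (image u Y) (lookup u i) ≡⟨ lookup-image-at u inj Y i ⟩
    lookup Y i                     ∎
    where open ≡-Reasoning

  lookup-∘ₚ : ∀ {n} (u v : Word n) i → lookup (u ∘ₚ v) i ≡ lookup u (lookup v i)
  lookup-∘ₚ u v i = VecP.lookup∘tabulate _ i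

  image-∘ₚ : ∀ {n} (u v : Word n) X → image u (image v X) ≡ image (u ∘ₚ v) X
  image-∘ₚ u v X = lookup-ext _ _ λ j → T-ext
    (λ t → let (i , t₁ , e₁) = ∈image⁻ u (image v X) j t
               (i′ , t₂ , e₂) = ∈image⁻ v X i t₁
           in subst (T ∘ lookup (image (u ∘ₚ v) X))
                    (trans (lookup-∘ₚ u v i′) (trans (cong (lookup u) e₂) e₁))
                    (∈image⁺ (u ∘ₚ v) X i′ t₂))
    (λ t → let (i , t₁ , e₁) = ∈image⁻ (u ∘ₚ v) X j t
           in subst (T ∘ lookup (image u (image v X)))
                    (trans (sym (lookup-∘ₚ u v i)) e₁)
                    (∈image⁺ u (image v X) (lookup v i) (∈image⁺ v X i t₁)))

  -- Pigeonhole: the image of an injective word of length n has n elements.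
  injective⇒surjective : ∀ {n} (w : Word n) → IsInjective w → ∀ j → ∃[ i ] lookup w i ≡ j
  injective⇒surjective {n} w inj j =
    let hit = count≡m⇒all _ (trans (count-image w inj (λ _ → true)) (count-true n)) j
        (i , t) = anyF⁻ {p = λ i → true ∧ (lookup w i ==F j)} hit
    in i , ==F⇒≡ t

  module _ {n} (w : Word n) (inj : IsInjective w) where

    inverse : Word n
    inverse = tabulate (proj₁ ∘ injective⇒surjective w inj)

    inverse-inverseʳ : ∀ j → lookup w (lookup inverse j) ≡ j
    inverse-inverseʳ j = trans (cong (lookup w) (VecP.lookup∘tabulate _ j)) (proj₂ (injective⇒surjective w inj j))

    inverse-inverseˡ : ∀ i → lookup inverse (lookup w i) ≡ i
    inverse-inverseˡ i = inj (inverse-inverseʳ (lookup w i))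

  open ListSum ℕP.+-*-commutativeSemiring

  ∑-boolToℕ-fins : ∀ n (p : Fin n → Bool) → ∑ (fins n) (boolToℕ ∘ p) ≡ count p
  ∑-boolToℕ-fins zero    p = refl
  ∑-boolToℕ-fins (suc n) p = cong (boolToℕ (p zero) +_)
    (trans (∑-map suc (fins n) (boolToℕ ∘ p)) (∑-boolToℕ-fins n (p ∘ suc)))

  -- The colour of a point records its membership in two subsets, i.e. its cell in their Venn diagram.
  Colour : Set
  Colour = Bool × Bool

  _==C_ : Colour → Colour → Bool
  κ ==C κ′ = ⌊ ×P.≡-dec Bool._≟_ Bool._≟_ κ κ′ ⌋

  ==C⇒≡ : ∀ {κ κ′} → T (κ ==C κ′) → κ ≡ κ′
  ==C⇒≡ = toWitness

  ≡⇒==C : ∀ {κ κ′} → κ ≡ κ′ → T (κ ==C κ′)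
  ≡⇒==C = fromWitness

  ==C-comm : ∀ κ κ′ → (κ ==C κ′) ≡ (κ′ ==C κ)
  ==C-comm κ κ′ = T-ext (≡⇒==C ∘ sym ∘ ==C⇒≡) (≡⇒==C ∘ sym ∘ ==C⇒≡)

  ∏Colour : (Colour → ℕ) → ℕ
  ∏Colour g = g (true , true) * g (true , false) * g (false , true) * g (false , false)

  #colour : ∀ {m} → (Fin m → Colour) → Colour → ℕ
  #colour c κ = count (λ i → c i ==C κ)

  respects : ∀ {n m} → (Fin m → Colour) → (Fin n → Colour) → Vec (Fin n) m → Bool
  respects c d v = allF (λ i → c i ==C d (lookup v i))

  ∏Colour-P′-suc : ∀ κ₀ (N M : Colour → ℕ) →
    ∏Colour (λ κ → N κ P′ (boolToℕ (κ₀ ==C κ) + M κ)) ≡ ∏Colour (λ κ → N κ P′ M κ) * (N κ₀ ∸ M κ₀)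
  ∏Colour-P′-suc (true  , true)  N M = pull₁ _ (F (true , true)) (F (true , false)) (F (false , true)) (F (false , false))
    where F = λ κ → N κ P′ M κ
          pull₁ : ∀ x a b c d → x * a * b * c * d ≡ a * b * c * d * x
          pull₁ = solve-∀
  ∏Colour-P′-suc (true  , false) N M = pull₂ _ (F (true , true)) (F (true , false)) (F (false , true)) (F (false , false))
    where F = λ κ → N κ P′ M κ
          pull₂ : ∀ x a b c d → a * (x * b) * c * d ≡ a * b * c * d * x
          pull₂ = solve-∀
  ∏Colour-P′-suc (false , true)  N M = pull₃ _ (F (true , true)) (F (true , false)) (F (false , true)) (F (false , false))
    where F = λ κ → N κ P′ M κ
          pull₃ : ∀ x a b c d → a * b * (x * c) * d ≡ a * b * c * d * x
          pull₃ = solve-∀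
  ∏Colour-P′-suc (false , false) N M = pull₄ _ (F (true , true)) (F (true , false)) (F (false , true)) (F (false , false))
    where F = λ κ → N κ P′ M κ
          pull₄ : ∀ x a b c d → a * b * c * (x * d) ≡ a * b * c * d * x
          pull₄ = solve-∀

  hits : ∀ {n m} → Vec (Fin n) m → Fin n → Bool
  hits v j = anyF (λ i → lookup v i ==F j)

  fresh : ∀ {n m} → Vec (Fin n) m → Fin n → Bool
  fresh v j = not (hits v j)

  IsInjective-∷⁻ : ∀ {n m} (i : Fin n) (v : Vec (Fin n) m) → IsInjective (i ∷ v) → IsInjective v × T (fresh v i)
  IsInjective-∷⁻ i v inj =
    FinP.suc-injective ∘ inj ,
    T-not⁺ λ t → let (a , tₐ) = anyF⁻ {p = λ a → lookup v a ==F i} t in FinP.0≢1+n (inj (sym (==F⇒≡ tₐ)))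

  IsInjective-∷⁺ : ∀ {n m} (i : Fin n) (v : Vec (Fin n) m) → IsInjective v → T (fresh v i) → IsInjective (i ∷ v)
  IsInjective-∷⁺ i v inj fr {zero}  {zero}  e = refl
  IsInjective-∷⁺ i v inj fr {zero}  {suc b} e = ⊥-elim (T-not⁻ fr (anyF⁺ {p = λ a → lookup v a ==F i} b (≡⇒==F (sym e))))
  IsInjective-∷⁺ i v inj fr {suc a} {zero}  e = ⊥-elim (T-not⁻ fr (anyF⁺ {p = λ a → lookup v a ==F i} a (≡⇒==F e)))
  IsInjective-∷⁺ i v inj fr {suc a} {suc b} e = cong suc (inj e)

  module _ {n m} (c : Fin (suc m) → Colour) (d : Fin n → Colour) where

    isInjective∧respects-∷ : ∀ (v : Vec (Fin n) m) i →
      (isInjective (i ∷ v) ∧ respects c d (i ∷ v)) ≡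
      ((isInjective v ∧ respects (c ∘ suc) d v) ∧ (fresh v i ∧ (c zero ==C d i)))
    isInjective∧respects-∷ v i = T-ext to from
      where
      to : T (isInjective (i ∷ v) ∧ respects c d (i ∷ v)) →
           T ((isInjective v ∧ respects (c ∘ suc) d v) ∧ (fresh v i ∧ (c zero ==C d i)))
      to t =
        let (inj , fr) = IsInjective-∷⁻ i v (isInjective⁻ (i ∷ v) (∧-elimˡ t))
            resp = ∧-elimʳ {isInjective (i ∷ v)} t
        in ∧-intro (∧-intro (isInjective⁺ v inj) (∧-elimʳ {c zero ==C d i} resp)) (∧-intro fr (∧-elimˡ resp))
      from : T ((isInjective v ∧ respects (c ∘ suc) d v) ∧ (fresh v i ∧ (c zero ==C d i))) →
             T (isInjective (i ∷ v) ∧ respects c d (i ∷ v))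
      from t =
        let tᵥ = ∧-elimˡ t
            tᵢ = ∧-elimʳ {isInjective v ∧ respects (c ∘ suc) d v} t
            inj = IsInjective-∷⁺ i v (isInjective⁻ v (∧-elimˡ tᵥ)) (∧-elimˡ tᵢ)
        in ∧-intro (isInjective⁺ (i ∷ v) inj) (∧-intro (∧-elimʳ {fresh v i} tᵢ) (∧-elimʳ {isInjective v} tᵥ))

  module _ {n m} (c : Fin m → Colour) (d : Fin n → Colour) (v : Vec (Fin n) m)
           (t : T (isInjective v ∧ respects c d v)) (κ : Colour) where

    private
      inj : IsInjective v
      inj = isInjective⁻ v (∧-elimˡ t)

      resp : ∀ a → c a ≡ d (lookup v a)
      resp a = ==C⇒≡ (allF⁻ (∧-elimʳ {isInjective v} t) a)
    count-hits-of-colour : count (λ j → hits v j ∧ (κ ==C d j)) ≡ #colour c κ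
    count-hits-of-colour = trans (count-cong same) (count-image v inj (λ a → c a ==C κ))
      where
      same : ∀ j → (hits v j ∧ (κ ==C d j)) ≡ anyF (λ a → (c a ==C κ) ∧ (lookup v a ==F j))
      same j = T-ext
        (λ t′ → let (a , tₐ) = anyF⁻ {p = λ a → lookup v a ==F j} (∧-elimˡ t′)
                    vₐ≡j = ==F⇒≡ tₐ
                in anyF⁺ {p = λ a → (c a ==C κ) ∧ (lookup v a ==F j)} a
                     (∧-intro (≡⇒==C (trans (resp a) (trans (cong d vₐ≡j) (sym (==C⇒≡ (∧-elimʳ {hits v j} t′))))))
                              tₐ))
        (λ t′ → let (a , tₐ) = anyF⁻ {p = λ a → (c a ==C κ) ∧ (lookup v a ==F j)} t′
                    vₐ≡j = ==F⇒≡ (∧-elimʳ {c a ==C κ} tₐ)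
                in ∧-intro (anyF⁺ {p = λ a → lookup v a ==F j} a (≡⇒==F vₐ≡j))
                           (≡⇒==C (trans (sym (==C⇒≡ (∧-elimˡ tₐ))) (trans (resp a) (cong d vₐ≡j)))))

    count-fresh-of-colour : count (λ j → fresh v j ∧ (κ ==C d j)) ≡ #colour d κ ∸ #colour c κ
    count-fresh-of-colour = sym (begin
      #colour d κ ∸ #colour c κ                                      ≡⟨ cong (_∸ #colour c κ) split ⟩
      #colour c κ + count (λ j → fresh v j ∧ (κ ==C d j)) ∸ #colour c κ ≡⟨ ℕP.m+n∸m≡n (#colour c κ) _ ⟩
      count (λ j → fresh v j ∧ (κ ==C d j))                          ∎)
      where
      open ≡-Reasoning
      split : #colour d κ ≡ #colour c κ + count (λ j → fresh v j ∧ (κ ==C d j))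
      split = begin
        #colour d κ                                        ≡⟨ count-cong (λ j → ==C-comm (d j) κ) ⟩
        count (λ j → κ ==C d j)                            ≡⟨ count-split (hits v) (λ j → κ ==C d j) ⟩
        count (λ j → hits v j ∧ (κ ==C d j)) + count (λ j → fresh v j ∧ (κ ==C d j))
                                                           ≡⟨ cong (_+ _) count-hits-of-colour ⟩
        #colour c κ + count (λ j → fresh v j ∧ (κ ==C d j)) ∎

  count-colourPreservingInjections : ∀ n m (c : Fin m → Colour) (d : Fin n → Colour) →
    ∑ (vecs n m) (λ v → boolToℕ (isInjective v ∧ respects c d v)) ≡ ∏Colour (λ κ → #colour d κ P′ #colour c κ)
  count-colourPreservingInjections n zero    c d = refl
  count-colourPreservingInjections n (suc m) c d = begin
    ∑ (vecs n (suc m)) (λ v → boolToℕ (isInjective v ∧ respects c d v))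
      ≡⟨ ∑-vecs-suc n m _ ⟩
    ∑ (vecs n m) (λ v → ∑ (fins n) (λ i → boolToℕ (isInjective (i ∷ v) ∧ respects c d (i ∷ v))))
      ≡⟨ ∑-cong (vecs n m) (λ v → trans (∑-boolToℕ-fins n (λ i → isInjective (i ∷ v) ∧ respects c d (i ∷ v)))
                                        (count-cong (isInjective∧respects-∷ c d v))) ⟩
    ∑ (vecs n m) (λ v → count (λ i → good v ∧ (fresh v i ∧ (κ₀ ==C d i))))
      ≡⟨ ∑-cong (vecs n m) extensions ⟩
    ∑ (vecs n m) (λ v → boolToℕ (good v) * (#colour d κ₀ ∸ #colour c′ κ₀))
      ≡⟨ ∑-*ʳ (vecs n m) _ _ ⟨
    ∑ (vecs n m) (boolToℕ ∘ good) * (#colour d κ₀ ∸ #colour c′ κ₀)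
      ≡⟨ cong (_* (#colour d κ₀ ∸ #colour c′ κ₀)) (count-colourPreservingInjections n m c′ d) ⟩
    ∏Colour (λ κ → #colour d κ P′ #colour c′ κ) * (#colour d κ₀ ∸ #colour c′ κ₀)
      ≡⟨ ∏Colour-P′-suc κ₀ (#colour d) (#colour c′) ⟨
    ∏Colour (λ κ → #colour d κ P′ #colour c κ)
      ∎
    where
    open ≡-Reasoning
    c′ = c ∘ suc
    κ₀ = c zero
    good = λ v → isInjective v ∧ respects c′ d v
    extensions : ∀ v → count (λ i → good v ∧ (fresh v i ∧ (κ₀ ==C d i))) ≡
                       boolToℕ (good v) * (#colour d κ₀ ∸ #colour c′ κ₀)
    extensions v with good v in good≡
    ... | true  = trans (count-fresh-of-colour c′ d v (subst T (sym good≡) tt) κ₀) (sym (ℕP.+-identityʳ _))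
    ... | false = count-false n

  venn : ∀ {n} → Subset n → Subset n → Fin n → Colour
  venn P Q i = lookup P i , lookup Q i

  cell : ∀ {n} → Colour → Subset n → Subset n → Subset n
  cell (true  , true ) P Q = P ∩ Q
  cell (true  , false) P Q = P ─ Q
  cell (false , true ) P Q = Q ─ P
  cell (false , false) P Q = ∁ (P ∪ Q)

  lookup-─ : ∀ {n} (P Q : Subset n) i → lookup (P ─ Q) i ≡ (lookup P i ∧ not (lookup Q i))
  lookup-─ (x ∷ P) (true  ∷ Q) zero    = sym (BoolP.∧-zeroʳ x)
  lookup-─ (x ∷ P) (false ∷ Q) zero    = sym (BoolP.∧-identityʳ x)
  lookup-─ (x ∷ P) (y     ∷ Q) (suc i) = lookup-─ P Q i

  inCell : Colour → Bool → Bool → Bool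
  inCell (true  , true ) x y = x ∧ y
  inCell (true  , false) x y = x ∧ not y
  inCell (false , true ) x y = y ∧ not x
  inCell (false , false) x y = not (x ∨ y)

  inCell≡==C : ∀ κ x y → inCell κ x y ≡ ((x , y) ==C κ)
  inCell≡==C (true  , true ) = λ { true true → refl ; true false → refl ; false true → refl ; false false → refl }
  inCell≡==C (true  , false) = λ { true true → refl ; true false → refl ; false true → refl ; false false → refl }
  inCell≡==C (false , true ) = λ { true true → refl ; true false → refl ; false true → refl ; false false → refl }
  inCell≡==C (false , false) = λ { true true → refl ; true false → refl ; false true → refl ; false false → refl }

  lookup-cell : ∀ {n} κ (P Q : Subset n) i → lookup (cell κ P Q) i ≡ inCell κ (lookup P i) (lookup Q i)
  lookup-cell (true  , true ) P Q i = VecP.lookup-zipWith _∧_ i P Q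
  lookup-cell (true  , false) P Q i = lookup-─ P Q i
  lookup-cell (false , true ) P Q i = lookup-─ Q P i
  lookup-cell (false , false) P Q i = trans (VecP.lookup-map i not (P ∪ Q)) (cong not (VecP.lookup-zipWith _∨_ i P Q))

  ∣cell∣ : ∀ {n} κ (P Q : Subset n) → ∣ cell κ P Q ∣ ≡ #colour (venn P Q) κ
  ∣cell∣ κ P Q = trans (∣∣≡count (cell κ P Q))
    (count-cong λ i → trans (lookup-cell κ P Q i) (inCell≡==C κ (lookup P i) (lookup Q i)))

  ∑Colour : (Colour → ℕ) → ℕ
  ∑Colour g = g (true , true) + g (true , false) + g (false , true) + g (false , false)

  count-proj₁ : ∀ {n} (e : Fin n → Colour) → count (proj₁ ∘ e) ≡ #colour e (true , true) + #colour e (true , false)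
  count-proj₁ {zero}  e = refl
  count-proj₁ {suc n} e with e zero | count-proj₁ (e ∘ suc)
  ... | true  , true  | ih = cong suc ih
  ... | true  , false | ih = trans (cong suc ih) (sym (ℕP.+-suc _ _))
  ... | false , true  | ih = ih
  ... | false , false | ih = ih

  count-proj₂ : ∀ {n} (e : Fin n → Colour) → count (proj₂ ∘ e) ≡ #colour e (true , true) + #colour e (false , true)
  count-proj₂ {zero}  e = refl
  count-proj₂ {suc n} e with e zero | count-proj₂ (e ∘ suc)
  ... | true  , true  | ih = cong suc ih
  ... | true  , false | ih = ih
  ... | false , true  | ih = trans (cong suc ih) (sym (ℕP.+-suc _ _))
  ... | false , false | ih = ih

  ∑Colour-#colour : ∀ {n} (e : Fin n → Colour) → ∑Colour (#colour e) ≡ n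
  ∑Colour-#colour {zero}  e = refl
  ∑Colour-#colour {suc n} e with e zero | ∑Colour-#colour (e ∘ suc)
  ... | true  , true  | ih = cong suc ih
  ... | true  , false | ih = trans (cong (λ x → x + C (false , true) + C (false , false)) (ℕP.+-suc _ _)) (cong suc ih)
    where C = #colour (e ∘ suc)
  ... | false , true  | ih = trans (cong (_+ C (false , false)) (ℕP.+-suc _ _)) (cong suc ih)
    where C = #colour (e ∘ suc)
  ... | false , false | ih = trans (ℕP.+-suc _ _) (cong suc ih)

  P′-diagonal : ∀ {a b} → a ≡ b → a P′ b ≡ b !
  P′-diagonal {a} refl = nP′n≡n! a

  P′-> : ∀ {a b} → a < b → a P′ b ≡ 0
  P′-> {a} {suc b} (s≤s a≤b) = cong (_* (a P′ b)) (ℕP.m≤n⇒m∸n≡0 a≤b)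

  ∏Colour-zero : ∀ g κ → g κ ≡ 0 → ∏Colour g ≡ 0
  ∏Colour-zero g (true  , true ) e rewrite e = refl
  ∏Colour-zero g (true  , false) e rewrite e | ℕP.*-zeroʳ (g (true , true)) = refl
  ∏Colour-zero g (false , true ) e rewrite e | ℕP.*-zeroʳ (g (true , true) * g (true , false)) = refl
  ∏Colour-zero g (false , false) e
    rewrite e | ℕP.*-zeroʳ (g (true , true) * g (true , false) * g (false , true)) = refl

  ∏Colour-cong : ∀ {f g : Colour → ℕ} → (∀ κ → f κ ≡ g κ) → ∏Colour f ≡ ∏Colour g
  ∏Colour-cong e = cong₂ _*_ (cong₂ _*_ (cong₂ _*_ (e _) (e _)) (e _)) (e _)

  *-ind-≢ : ∀ {x a b} → a ≢ b → x * boolToℕ (a ==ℕ b) ≡ 0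
  *-ind-≢ {x} a≢b = trans (cong (λ b → x * boolToℕ b) (==ℕ-≢ a≢b)) (ℕP.*-zeroʳ x)

  -- When the two intersections have different sizes, some cell of M is larger than the matching cell of N.
  ∏Colour-P′ : ∀ (N M : Colour → ℕ) →
    M (true , true) + M (true , false) ≡ N (true , true) + N (true , false) →
    M (true , true) + M (false , true) ≡ N (true , true) + N (false , true) →
    ∑Colour M ≡ ∑Colour N →
    ∏Colour (λ κ → N κ P′ M κ) ≡ ∏Colour (λ κ → M κ !) * boolToℕ (N (true , true) ==ℕ M (true , true))
  ∏Colour-P′ N M row col total with ℕP.<-cmp (M (true , true)) (N (true , true))
  ... | tri≈ _ M≡N _ =
    begin
      ∏Colour (λ κ → N κ P′ M κ)  ≡⟨ ∏Colour-cong (λ κ → P′-diagonal (sym (same κ))) ⟩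
      ∏Colour (λ κ → M κ !)       ≡⟨ ℕP.*-identityʳ _ ⟨
      ∏Colour (λ κ → M κ !) * 1   ≡⟨ cong (λ b → ∏Colour (λ κ → M κ !) * boolToℕ b) (==ℕ-refl _) ⟨
      ∏Colour (λ κ → M κ !) * boolToℕ (N (true , true) ==ℕ N (true , true))
                                  ≡⟨ cong (λ x → ∏Colour (λ κ → M κ !) * boolToℕ (N (true , true) ==ℕ x)) M≡N ⟨
      ∏Colour (λ κ → M κ !) * boolToℕ (N (true , true) ==ℕ M (true , true))
    ∎
    where
    open ≡-Reasoning
    same : ∀ κ → M κ ≡ N κ
    same (true  , true ) = M≡N
    same (true  , false) = ℕP.+-cancelˡ-≡ _ _ _ (trans row (cong (_+ _) (sym M≡N)))
    same (false , true ) = ℕP.+-cancelˡ-≡ _ _ _ (trans col (cong (_+ _) (sym M≡N)))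
    same (false , false) = ℕP.+-cancelˡ-≡ _ _ _ (trans total
      (cong (λ x → x + N (false , false)) (sym (cong₂ _+_ (cong₂ _+_ M≡N (same (true , false))) (same (false , true))))))
  ... | tri> _ M≢N N<M = trans (∏Colour-zero (λ κ → N κ P′ M κ) (true , true) (P′-> N<M)) (sym (*-ind-≢ {∏Colour (λ κ → M κ !)} (M≢N ∘ sym)))
  ... | tri< M<N M≢N _ = trans (∏Colour-zero (λ κ → N κ P′ M κ) (true , false) (P′-> N<M)) (sym (*-ind-≢ {∏Colour (λ κ → M κ !)} (M≢N ∘ sym)))
    where
    N<M : N (true , false) < M (true , false)
    N<M = ℕP.+-cancelˡ-< (M (true , true)) _ _
            (ℕP.<-≤-trans (ℕP.+-monoˡ-< (N (true , false)) M<N) (ℕP.≤-reflexive (sym row)))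

  ∏Colour-P′-venn : ∀ {n} (B C Y D : Subset n) → ∣ B ∣ ≡ ∣ Y ∣ → ∣ C ∣ ≡ ∣ D ∣ →
    ∏Colour (λ κ → #colour (venn Y D) κ P′ #colour (venn B C) κ) ≡ ω B C * boolToℕ (∣ Y ∩ D ∣ ==ℕ ∣ B ∩ C ∣)
  ∏Colour-P′-venn {n} B C Y D ∣B∣≡∣Y∣ ∣C∣≡∣D∣ = begin
    ∏Colour (λ κ → N κ P′ M κ)
      ≡⟨ ∏Colour-P′ N M row col (trans (∑Colour-#colour (venn B C)) (sym (∑Colour-#colour (venn Y D)))) ⟩
    ∏Colour (λ κ → M κ !) * boolToℕ (N (true , true) ==ℕ M (true , true))
      ≡⟨ cong₂ (λ x y → x * boolToℕ y) (∏Colour-cong (λ κ → cong _! (sym (∣cell∣ κ B C))))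
                                         (sym (cong₂ _==ℕ_ (∣cell∣ _ Y D) (∣cell∣ _ B C))) ⟩
    ω B C * boolToℕ (∣ Y ∩ D ∣ ==ℕ ∣ B ∩ C ∣)
      ∎
    where
    open ≡-Reasoning
    N = #colour (venn Y D)
    M = #colour (venn B C)
    row : M (true , true) + M (true , false) ≡ N (true , true) + N (true , false)
    row = trans (sym (count-proj₁ (venn B C)))
            (trans (sym (∣∣≡count B)) (trans ∣B∣≡∣Y∣ (trans (∣∣≡count Y) (count-proj₁ (venn Y D)))))
    col : M (true , true) + M (false , true) ≡ N (true , true) + N (false , true)
    col = trans (sym (count-proj₂ (venn B C)))
            (trans (sym (∣∣≡count C)) (trans ∣C∣≡∣D∣ (trans (∣∣≡count D) (count-proj₂ (venn Y D)))))

  _==V_ : ∀ {n m} → Vec (Fin n) m → Vec (Fin n) m → Bool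
  u ==V v = ⌊ VecP.≡-dec FinP._≟_ u v ⌋

  ==V-∷ : ∀ {n m} (i j : Fin n) (u v : Vec (Fin n) m) → ((i ∷ u) ==V (j ∷ v)) ≡ ((u ==V v) ∧ (i ==F j))
  ==V-∷ i j u v = T-ext
    (λ t → let e = toWitness {a? = VecP.≡-dec FinP._≟_ (i ∷ u) (j ∷ v)} t in
           ∧-intro (fromWitness {a? = VecP.≡-dec FinP._≟_ u v} (VecP.∷-injectiveʳ e)) (≡⇒==F (VecP.∷-injectiveˡ e)))
    (λ t → fromWitness (cong₂ _∷_ (==F⇒≡ (∧-elimʳ {u ==V v} t)) (toWitness {a? = VecP.≡-dec FinP._≟_ u v} (∧-elimˡ t))))

  module _ {n} (u : Word n) (inj : IsInjective u) (w : Word n) where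

    ∘ₚ-inverse : u ∘ₚ (inverse u inj ∘ₚ w) ≡ w
    ∘ₚ-inverse = lookup-ext _ _ λ i → begin
      lookup (u ∘ₚ (inverse u inj ∘ₚ w)) i        ≡⟨ lookup-∘ₚ u (inverse u inj ∘ₚ w) i ⟩
      lookup u (lookup (inverse u inj ∘ₚ w) i)    ≡⟨ cong (lookup u) (lookup-∘ₚ (inverse u inj) w i) ⟩
      lookup u (lookup (inverse u inj) (lookup w i)) ≡⟨ inverse-inverseʳ u inj (lookup w i) ⟩
      lookup w i                                  ∎
      where open ≡-Reasoning

    ==W-∘ₚ≡==V-inverse∘ₚ : ∀ v → ((u ∘ₚ v) ==W w) ≡ (v ==V (inverse u inj ∘ₚ w))
    ==W-∘ₚ≡==V-inverse∘ₚ v = T-ext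
      (λ t → fromWitness (lookup-ext _ _ λ i → begin
        lookup v i                                 ≡⟨ inverse-inverseˡ u inj (lookup v i) ⟨
        lookup (inverse u inj) (lookup u (lookup v i)) ≡⟨ cong (lookup (inverse u inj)) (lookup-∘ₚ u v i) ⟨
        lookup (inverse u inj) (lookup (u ∘ₚ v) i)  ≡⟨ cong (λ x → lookup (inverse u inj) (lookup x i)) (toWitness t) ⟩
        lookup (inverse u inj) (lookup w i)         ≡⟨ lookup-∘ₚ (inverse u inj) w i ⟨
        lookup (inverse u inj ∘ₚ w) i               ∎))
      (λ t → fromWitness (trans (cong (u ∘ₚ_) (toWitness t)) ∘ₚ-inverse))
      where open ≡-Reasoning

    image-inverse∘ₚ : ∀ A B → (image (inverse u inj ∘ₚ w) A ==S B) ≡ (image u B ==S image w A)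
    image-inverse∘ₚ A B = T-ext
      (λ t → ≡⇒==S (trans (cong (image u) (sym (==S⇒≡ t))) u[v₀A]≡wA))
      (λ t → ≡⇒==S (sym (image-injective u inj B (image v₀ A) (trans (==S⇒≡ t) (sym u[v₀A]≡wA)))))
      where
      v₀ = inverse u inj ∘ₚ w
      u[v₀A]≡wA : image u (image v₀ A) ≡ image w A
      u[v₀A]≡wA = trans (image-∘ₚ u v₀ A) (cong (λ x → image x A) ∘ₚ-inverse)

    inverse∘ₚ-injective : IsInjective w → IsInjective (inverse u inj ∘ₚ w)
    inverse∘ₚ-injective injw {a} {b} e = injw (begin
      lookup w a                                  ≡⟨ cong (λ x → lookup x a) ∘ₚ-inverse ⟨
      lookup (u ∘ₚ (inverse u inj ∘ₚ w)) a        ≡⟨ lookup-∘ₚ u (inverse u inj ∘ₚ w) a ⟩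
      lookup u (lookup (inverse u inj ∘ₚ w) a)    ≡⟨ cong (lookup u) e ⟩
      lookup u (lookup (inverse u inj ∘ₚ w) b)    ≡⟨ lookup-∘ₚ u (inverse u inj ∘ₚ w) b ⟨
      lookup (u ∘ₚ (inverse u inj ∘ₚ w)) b        ≡⟨ cong (λ x → lookup x b) ∘ₚ-inverse ⟩
      lookup w b                                  ∎)
      where open ≡-Reasoning

  transports≡respects : ∀ {n} (u : Word n) (B C Y D : Subset n) →
    (isPerm u ∧ ((image u C ==S D) ∧ (image u B ==S Y))) ≡ (isInjective u ∧ respects (venn B C) (venn Y D) u)
  transports≡respects u B C Y D = T-ext to from
    where
    to : T (isPerm u ∧ ((image u C ==S D) ∧ (image u B ==S Y))) → T (isInjective u ∧ respects (venn B C) (venn Y D) u)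
    to t = ∧-intro (∧-elimˡ {isPerm u} t) (allF⁺ λ i → ≡⇒==C (cong₂ _,_ (along B Y uB≡Y i) (along C D uC≡D i)))
      where
      inj = isInjective⁻ u (∧-elimˡ {isPerm u} t)
      t′ = ∧-elimʳ {isPerm u} t
      uC≡D = ==S⇒≡ (∧-elimˡ {image u C ==S D} t′)
      uB≡Y = ==S⇒≡ (∧-elimʳ {image u C ==S D} t′)
      along : ∀ X Z → image u X ≡ Z → ∀ i → lookup X i ≡ lookup Z (lookup u i)
      along X Z e i = trans (sym (lookup-image-at u inj X i)) (cong (λ S → lookup S (lookup u i)) e)
    from : T (isInjective u ∧ respects (venn B C) (venn Y D) u) → T (isPerm u ∧ ((image u C ==S D) ∧ (image u B ==S Y)))
    from t = ∧-intro (∧-elimˡ {isInjective u} t) (∧-intro (≡⇒==S uC≡D) (≡⇒==S uB≡Y))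
      where
      inj = isInjective⁻ u (∧-elimˡ {isInjective u} t)
      resp : ∀ i → venn B C i ≡ venn Y D (lookup u i)
      resp i = ==C⇒≡ (allF⁻ (∧-elimʳ {isInjective u} t) i)
      transported : ∀ X Z (π : Colour → Bool) → (∀ i → lookup X i ≡ π (venn B C i)) →
                    (∀ j → lookup Z j ≡ π (venn Y D j)) → image u X ≡ Z
      transported X Z π X≡ Z≡ = lookup-ext _ _ λ j →
        let (i , uᵢ≡j) = injective⇒surjective u inj j in
        subst (λ j → lookup (image u X) j ≡ lookup Z j) uᵢ≡j
          (trans (lookup-image-at u inj X i) (trans (X≡ i) (trans (cong π (resp i)) (sym (Z≡ (lookup u i))))))
      uC≡D = transported C D proj₂ (λ _ → refl) (λ _ → refl)
      uB≡Y = transported B Y proj₁ (λ _ → refl) (λ _ → refl)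

  preimage : ∀ {n} → Word n → Subset n → Subset n
  preimage w D = tabulate (lookup D ∘ lookup w)

  lookup-∩ : ∀ {n} (X Y : Subset n) i → lookup (X ∩ Y) i ≡ (lookup X i ∧ lookup Y i)
  lookup-∩ X Y i = VecP.lookup-zipWith _∧_ i X Y

  lookup-preimage : ∀ {n} (w : Word n) D i → lookup (preimage w D) i ≡ lookup D (lookup w i)
  lookup-preimage w D i = VecP.lookup∘tabulate _ i

  ∈∩⁻ : ∀ {n} (X Y : Subset n) i → T (lookup (X ∩ Y) i) → T (lookup X i) × T (lookup Y i)
  ∈∩⁻ X Y i t = let t′ = subst T (lookup-∩ X Y i) t in ∧-elimˡ t′ , ∧-elimʳ {lookup X i} t′

  ∈∩⁺ : ∀ {n} (X Y : Subset n) i → T (lookup X i) → T (lookup Y i) → T (lookup (X ∩ Y) i)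
  ∈∩⁺ X Y i x y = subst T (sym (lookup-∩ X Y i)) (∧-intro x y)

  ∈preimage⁻ : ∀ {n} (w : Word n) D i → T (lookup (preimage w D) i) → T (lookup D (lookup w i))
  ∈preimage⁻ w D i = subst T (lookup-preimage w D i)

  ∈preimage⁺ : ∀ {n} (w : Word n) D i → T (lookup D (lookup w i)) → T (lookup (preimage w D) i)
  ∈preimage⁺ w D i = subst T (sym (lookup-preimage w D i))

  image-∩-preimage : ∀ {n} (w : Word n) X D → image w (X ∩ preimage w D) ≡ image w X ∩ D
  image-∩-preimage w X D = lookup-ext _ _ λ j → T-ext
    (λ t → let (i , tᵢ , wᵢ≡j) = ∈image⁻ w (X ∩ preimage w D) j t
               (x , d) = ∈∩⁻ X (preimage w D) i tᵢ
           in subst (T ∘ lookup (image w X ∩ D)) wᵢ≡j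
                    (∈∩⁺ (image w X) D (lookup w i) (∈image⁺ w X i x) (∈preimage⁻ w D i d)))
    (λ t → let (wx , d) = ∈∩⁻ (image w X) D j t
               (i , x , wᵢ≡j) = ∈image⁻ w X j wx
           in subst (T ∘ lookup (image w (X ∩ preimage w D))) wᵢ≡j
                    (∈image⁺ w (X ∩ preimage w D) i (∈∩⁺ X (preimage w D) i x (∈preimage⁺ w D i (subst (T ∘ lookup D) (sym wᵢ≡j) d)))))

  ∣∩preimage∣ : ∀ {n} (w : Word n) → IsInjective w → ∀ X D → ∣ X ∩ preimage w D ∣ ≡ ∣ image w X ∩ D ∣
  ∣∩preimage∣ w inj X D = trans (sym (∣image∣ w inj (X ∩ preimage w D))) (cong ∣_∣ (image-∩-preimage w X D))

  ⊆ᵇ⁻ : ∀ {n} (X Y : Subset n) → T (X ⊆ᵇ Y) → ∀ i → T (lookup X i) → T (lookup Y i)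
  ⊆ᵇ⁻ X Y t i x with ∨-elim {not (lookup X i)} (allF⁻ {p = λ i → not (lookup X i) ∨ lookup Y i} t i)
  ... | inj₁ t′ = ⊥-elim (T-not⁻ t′ x)
  ... | inj₂ y  = y

  ⊆ᵇ⁺ : ∀ {n} (X Y : Subset n) → (∀ i → T (lookup X i) → T (lookup Y i)) → T (X ⊆ᵇ Y)
  ⊆ᵇ⁺ X Y f = allF⁺ pointwise
    where
    pointwise : ∀ i → T (not (lookup X i) ∨ lookup Y i)
    pointwise i with lookup X i in xᵢ
    ... | true  = f i (subst T (sym xᵢ) tt)
    ... | false = tt

  ⊆ᵇ-∩-preimage : ∀ {n} (w : Word n) (A D V : Subset n) →
                  ((V ⊆ᵇ A) ∧ (image w V ⊆ᵇ D)) ≡ (V ⊆ᵇ (A ∩ preimage w D))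
  ⊆ᵇ-∩-preimage w A D V = T-ext
    (λ t → ⊆ᵇ⁺ V (A ∩ preimage w D) λ i v → ∈∩⁺ A (preimage w D) i (⊆ᵇ⁻ V A (∧-elimˡ t) i v)
             (∈preimage⁺ w D i (⊆ᵇ⁻ (image w V) D (∧-elimʳ {V ⊆ᵇ A} t) (lookup w i) (∈image⁺ w V i v))))
    (λ t → ∧-intro (⊆ᵇ⁺ V A λ i v → proj₁ (∈∩⁻ A (preimage w D) i (⊆ᵇ⁻ V (A ∩ preimage w D) t i v)))
                   (⊆ᵇ⁺ (image w V) D λ j wv →
                      let (i , v , wᵢ≡j) = ∈image⁻ w V j wv in
                      subst (T ∘ lookup D) wᵢ≡j (∈preimage⁻ w D i (proj₂ (∈∩⁻ A (preimage w D) i (⊆ᵇ⁻ V (A ∩ preimage w D) t i v))))))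

  admissible : ∀ {n} (A D U V : Subset n) → Bool
  admissible A D U V = (U ⊆ᵇ D) ∧ (V ⊆ᵇ A) ∧ (∣ U ∣ ==ℕ ∣ V ∣)

  admissible-image : ∀ {n} (w : Word n) → IsInjective w → ∀ A D V → admissible A D (image w V) V ≡ (V ⊆ᵇ (A ∩ preimage w D))
  admissible-image w injw A D V = begin
    (image w V ⊆ᵇ D) ∧ (V ⊆ᵇ A) ∧ (∣ image w V ∣ ==ℕ ∣ V ∣) ≡⟨ cong (λ x → (image w V ⊆ᵇ D) ∧ (V ⊆ᵇ A) ∧ (x ==ℕ ∣ V ∣)) (∣image∣ w injw V) ⟩
    (image w V ⊆ᵇ D) ∧ (V ⊆ᵇ A) ∧ (∣ V ∣ ==ℕ ∣ V ∣)         ≡⟨ cong (λ b → (image w V ⊆ᵇ D) ∧ (V ⊆ᵇ A) ∧ b) (==ℕ-refl ∣ V ∣) ⟩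
    (image w V ⊆ᵇ D) ∧ (V ⊆ᵇ A) ∧ true                     ≡⟨ cong ((image w V ⊆ᵇ D) ∧_) (BoolP.∧-identityʳ (V ⊆ᵇ A)) ⟩
    (image w V ⊆ᵇ D) ∧ (V ⊆ᵇ A)                            ≡⟨ BoolP.∧-comm (image w V ⊆ᵇ D) (V ⊆ᵇ A) ⟩
    (V ⊆ᵇ A) ∧ (image w V ⊆ᵇ D)                            ≡⟨ ⊆ᵇ-∩-preimage w A D V ⟩
    V ⊆ᵇ (A ∩ preimage w D)                                ∎
    where open ≡-Reasoning

module _ {c ℓ} (R : CommutativeRing c ℓ) (n : ℕ) where
  open CommutativeRing R renaming (refl to ≈-refl; sym to ≈-sym; trans to ≈-trans) hiding (zero)
  open GroupAlgebra R n
  open ListSum commutativeSemiring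
  private module ℕ∑ = ListSum ℕP.+-*-commutativeSemiring
  open import Relation.Binary.Reasoning.Setoid setoid
  open import Relation.Nullary.Decidable using (T?)
  open import Data.Nat.Combinatorics.Base using (_P′_)
  open import Algebra.Properties.Ring ring using (-‿distribˡ-*)
  open import Algebra.Properties.CommutativeSemigroup *-commutativeSemigroup
    using () renaming (x∙yz≈y∙xz to *-x∙yz≈y∙xz)

  ι-+ : ∀ a b → ι (a ℕ.+ b) ≈ ι a + ι b
  ι-+ zero    b = ≈-sym (+-identityˡ _)
  ι-+ (suc a) b = ≈-trans (+-congˡ (ι-+ a b)) (≈-sym (+-assoc _ _ _))

  ι-* : ∀ a b → ι (a ℕ.* b) ≈ ι a * ι b
  ι-* zero    b = ≈-sym (zeroˡ _)
  ι-* (suc a) b = ≈-trans (ι-+ b (a ℕ.* b)) (≈-trans (+-cong (≈-sym (*-identityˡ _)) (ι-* a b)) (≈-sym (distribʳ _ _ _)))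

  ind≈ι : ∀ b → ind b ≈ ι (boolToℕ b)
  ind≈ι true  = ≈-sym (+-identityʳ 1#)
  ind≈ι false = ≈-refl

  ind-∧ : ∀ a b → ind (a ∧ b) ≈ ind a * ind b
  ind-∧ true  b = ≈-sym (*-identityˡ _)
  ind-∧ false b = ≈-sym (zeroˡ _)

  ∑-ind≈ι : ∀ {a} {X : Set a} (xs : List X) (p : X → Bool) → ∑ xs (ind ∘ p) ≈ ι (ℕ∑.∑ xs (boolToℕ ∘ p))
  ∑-ind≈ι []       p = ≈-refl
  ∑-ind≈ι (x ∷ xs) p = ≈-trans (+-cong (ind≈ι (p x)) (∑-ind≈ι xs p)) (≈-sym (ι-+ (boolToℕ (p x)) _))

  ∑-filter : ∀ {a} {X : Set a} (p : X → Bool) (xs : List X) (f : X → Carrier) →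
             ∑ (filter (T? ∘ p) xs) f ≈ ∑ xs (λ x → ind (p x) * f x)
  ∑-filter p []       f = ≈-refl
  ∑-filter p (x ∷ xs) f with p x
  ... | true  = +-cong (≈-sym (*-identityˡ _)) (∑-filter p xs f)
  ... | false = ≈-trans (≈-sym (+-identityˡ _)) (+-cong (≈-sym (zeroˡ _)) (∑-filter p xs f))

  ∑-fins-δ : ∀ m (a : Fin m) (g : Fin m → Carrier) → ∑ (fins m) (λ i → ind (i ==F a) * g i) ≈ g a
  ∑-fins-δ (suc m) zero g = begin
    1# * g zero + ∑ (map suc (fins m)) (λ i → ind (i ==F zero) * g i) ≡⟨ ≡.cong (1# * g zero +_) (∑-map suc (fins m) _) ⟩
    1# * g zero + ∑ (fins m) (λ i → 0# * g (suc i))                  ≈⟨ +-cong (*-identityˡ _) (∑-zero (fins m) (λ i → zeroˡ _)) ⟩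
    g zero + 0#                                                      ≈⟨ +-identityʳ _ ⟩
    g zero                                                           ∎
  ∑-fins-δ (suc m) (suc a) g = begin
    0# * g zero + ∑ (map suc (fins m)) (λ i → ind (i ==F suc a) * g i) ≡⟨ ≡.cong (0# * g zero +_) (∑-map suc (fins m) _) ⟩
    0# * g zero + ∑ (fins m) (λ i → ind (suc i ==F suc a) * g (suc i)) ≈⟨ ≈-trans (+-congʳ (zeroˡ _)) (+-identityˡ _) ⟩
    ∑ (fins m) (λ i → ind (suc i ==F suc a) * g (suc i))              ≈⟨ ∑-cong (fins m) (λ i → *-congʳ (reflexive (≡.cong ind (==F-suc i a)))) ⟩
    ∑ (fins m) (λ i → ind (i ==F a) * g (suc i))                      ≈⟨ ∑-fins-δ m a (g ∘ suc) ⟩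
    g (suc a)                                                         ∎

  ∑-vecs-δ : ∀ {k} m (a : Vec (Fin k) m) (g : Vec (Fin k) m → Carrier) → ∑ (vecs k m) (λ v → ind (v ==V a) * g v) ≈ g a
  ∑-vecs-δ zero    []       g = ≈-trans (+-identityʳ _) (*-identityˡ _)
  ∑-vecs-δ {k} (suc m) (a₀ ∷ a) g = begin
    ∑ (vecs k (suc m)) (λ v → ind (v ==V (a₀ ∷ a)) * g v)
      ≈⟨ ∑-vecs-suc k m _ ⟩
    ∑ (vecs k m) (λ v → ∑ (fins k) (λ i → ind ((i ∷ v) ==V (a₀ ∷ a)) * g (i ∷ v)))
      ≈⟨ ∑-cong (vecs k m) (λ v → ∑-cong (fins k) (λ i → split v i)) ⟩
    ∑ (vecs k m) (λ v → ∑ (fins k) (λ i → ind (v ==V a) * (ind (i ==F a₀) * g (i ∷ v))))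
      ≈⟨ ∑-cong (vecs k m) (λ v → ≈-trans (≈-sym (∑-*ˡ (fins k) _ _)) (*-congˡ (∑-fins-δ k a₀ (λ i → g (i ∷ v))))) ⟩
    ∑ (vecs k m) (λ v → ind (v ==V a) * g (a₀ ∷ v))
      ≈⟨ ∑-vecs-δ m a (λ v → g (a₀ ∷ v)) ⟩
    g (a₀ ∷ a)
      ∎
    where
    split : ∀ v i → ind ((i ∷ v) ==V (a₀ ∷ a)) * g (i ∷ v) ≈ ind (v ==V a) * (ind (i ==F a₀) * g (i ∷ v))
    split v i = ≈-trans (*-congʳ (≈-trans (reflexive (≡.cong ind (==V-∷ i a₀ v a))) (ind-∧ _ _))) (*-assoc _ _ _)

  ∑-Bool-δ : ∀ x (f : Bool → Carrier) → ind ⌊ x Bool.≟ true ⌋ * f true + ind ⌊ x Bool.≟ false ⌋ * f false ≈ f x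
  ∑-Bool-δ true  f = ≈-trans (+-cong (*-identityˡ _) (zeroˡ _)) (+-identityʳ _)
  ∑-Bool-δ false f = ≈-trans (+-cong (zeroˡ _) (*-identityˡ _)) (+-identityˡ _)

  ∑-subsets-δ : ∀ m (X : Subset m) (g : Subset m → Carrier) → ∑ (subsets m) (λ U → ind (X ==S U) * g U) ≈ g X
  ∑-subsets-δ zero    []      g = ≈-trans (+-identityʳ _) (*-identityˡ _)
  ∑-subsets-δ (suc m) (x ∷ X) g = begin
    ∑ (subsets (suc m)) (λ U → ind ((x ∷ X) ==S U) * g U)                  ≈⟨ ∑-subsets-suc m _ ⟩
    ∑ (subsets m) (λ U → term true U + term false U)                       ≈⟨ ∑-cong (subsets m) (λ U →
                                                                                ≈-trans (+-cong (split true U) (split false U))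
                                                                                        (∑-Bool-δ x (λ y → ind (X ==S U) * g (y ∷ U)))) ⟩
    ∑ (subsets m) (λ U → ind (X ==S U) * g (x ∷ U))                        ≈⟨ ∑-subsets-δ m X (λ U → g (x ∷ U)) ⟩
    g (x ∷ X)                                                              ∎
    where
    term : Bool → Subset m → Carrier
    term y U = ind ((x ∷ X) ==S (y ∷ U)) * g (y ∷ U)
    split : ∀ y U → term y U ≈ ind ⌊ x Bool.≟ y ⌋ * (ind (X ==S U) * g (y ∷ U))
    split y U = ≈-trans (*-congʳ (≈-trans (reflexive (≡.cong ind (==S-∷ x y X U))) (ind-∧ _ _))) (*-assoc _ _ _)

  Σ𝒜-apply : ∀ {a} {X : Set a} (xs : List X) (f : X → 𝒜) w → Σ𝒜 xs f w ≡ ∑ xs (λ x → f x w)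
  Σ𝒜-apply []       f w = ≡.refl
  Σ𝒜-apply (x ∷ xs) f w = ≡.cong (f x w +_) (Σ𝒜-apply xs f w)

  ∑-Sym : (f : Word n → Carrier) → ∑ (Sym n) f ≈ ∑ (vecs n n) (λ u → ind (isPerm u) * f u)
  ∑-Sym = ∑-filter isPerm (vecs n n)

  ∑-Sym-∘ₚ-δ : ∀ (u w : Word n) (inju : IsInjective u) → IsInjective w → (f : Word n → Carrier) →
               ∑ (Sym n) (λ v → ind ((u ∘ₚ v) ==W w) * f v) ≈ f (inverse u inju ∘ₚ w)
  ∑-Sym-∘ₚ-δ u w inju injw f = begin
    ∑ (Sym n) (λ v → ind ((u ∘ₚ v) ==W w) * f v)
      ≈⟨ ∑-Sym _ ⟩
    ∑ (vecs n n) (λ v → ind (isPerm v) * (ind ((u ∘ₚ v) ==W w) * f v))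
      ≈⟨ ∑-cong (vecs n n) (λ v → ≈-trans (*-congˡ (*-congʳ (reflexive (≡.cong ind (==W-∘ₚ≡==V-inverse∘ₚ u inju w v)))))
                                         (*-x∙yz≈y∙xz _ _ _)) ⟩
    ∑ (vecs n n) (λ v → ind (v ==V v₀) * (ind (isPerm v) * f v))
      ≈⟨ ∑-vecs-δ n v₀ (λ v → ind (isPerm v) * f v) ⟩
    ind (isPerm v₀) * f v₀
      ≈⟨ *-congʳ (reflexive (≡.cong ind (T⇒≡true (isInjective⁺ v₀ (inverse∘ₚ-injective u inju w injw))))) ⟩
    1# * f v₀
      ≈⟨ *-identityˡ _ ⟩
    f v₀
      ∎
    where
    v₀ = inverse u inju ∘ₚ w

  module _ (A B C D : Subset n) (w : Word n) (injw : IsInjective w) where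

    transports : Word n → Bool
    transports u = (image u C ==S D) ∧ (image u B ==S image w A)

    ∇⊛∇≈∑transports : (∇ D C ⊛ ∇ B A) w ≈ ∑ (vecs n n) (λ u → ind (isPerm u ∧ transports u))
    ∇⊛∇≈∑transports = ≈-trans (∑-Sym _) (∑-cong (vecs n n) term)
      where
      term : ∀ u → ind (isPerm u) * ∑ (Sym n) (λ v → ind ((u ∘ₚ v) ==W w) * (∇ D C u * ∇ B A v))
                   ≈ ind (isPerm u ∧ transports u)
      term u with isPerm u in perm
      ... | false = zeroˡ _
      ... | true  = let inju = isInjective⁻ u (subst T (≡.sym perm) tt) in begin
        1# * ∑ (Sym n) (λ v → ind ((u ∘ₚ v) ==W w) * (∇ D C u * ∇ B A v))
          ≈⟨ *-identityˡ _ ⟩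
        ∑ (Sym n) (λ v → ind ((u ∘ₚ v) ==W w) * (∇ D C u * ∇ B A v))
          ≈⟨ ∑-Sym-∘ₚ-δ u w inju injw (λ v → ∇ D C u * ∇ B A v) ⟩
        ind (image u C ==S D) * ind (image (inverse u inju ∘ₚ w) A ==S B)
          ≈⟨ *-congˡ (reflexive (≡.cong ind (image-inverse∘ₚ u inju w A B))) ⟩
        ind (image u C ==S D) * ind (image u B ==S image w A)
          ≈⟨ ind-∧ _ _ ⟨
        ind (transports u)
          ∎

    ∇⊛∇≈ω·δ : ∣ A ∣ ≡ ∣ B ∣ → ∣ C ∣ ≡ ∣ D ∣ →
              (∇ D C ⊛ ∇ B A) w ≈ ι (ω B C) * ind (∣ image w A ∩ D ∣ ==ℕ ∣ B ∩ C ∣)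
    ∇⊛∇≈ω·δ ∣A∣≡∣B∣ ∣C∣≡∣D∣ = begin
      (∇ D C ⊛ ∇ B A) w
        ≈⟨ ∇⊛∇≈∑transports ⟩
      ∑ (vecs n n) (λ u → ind (isPerm u ∧ transports u))
        ≈⟨ ∑-ind≈ι (vecs n n) _ ⟩
      ι (ℕ∑.∑ (vecs n n) (λ u → boolToℕ (isPerm u ∧ transports u)))
        ≡⟨ ≡.cong ι (ℕ∑.∑-cong (vecs n n) (λ u → ≡.cong boolToℕ (transports≡respects u B C (image w A) D))) ⟩
      ι (ℕ∑.∑ (vecs n n) (λ u → boolToℕ (isInjective u ∧ respects (venn B C) (venn (image w A) D) u)))
        ≡⟨ ≡.cong ι (count-colourPreservingInjections n n (venn B C) (venn (image w A) D)) ⟩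
      ι (∏Colour (λ κ → #colour (venn (image w A) D) κ P′ #colour (venn B C) κ))
        ≡⟨ ≡.cong ι (∏Colour-P′-venn B C (image w A) D (≡.trans (≡.sym ∣A∣≡∣B∣) (≡.sym (∣image∣ w injw A))) ∣C∣≡∣D∣) ⟩
      ι (ω B C ℕ.* boolToℕ (∣ image w A ∩ D ∣ ==ℕ ∣ B ∩ C ∣))
        ≈⟨ ≈-trans (ι-* (ω B C) _) (*-congˡ (≈-sym (ind≈ι _))) ⟩
      ι (ω B C) * ind (∣ image w A ∩ D ∣ ==ℕ ∣ B ∩ C ∣)
        ∎

  signedBinomial : ℕ → ℕ → Carrier
  signedBinomial k j = sgn (j ∸ k) * ι (j Comb.C k)

  private
    -s*x+s*x≈0 : ∀ s x → - s * x + s * x ≈ 0#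
    -s*x+s*x≈0 s x = ≈-trans (+-congʳ (≈-sym (-‿distribˡ-* s x))) (-‿inverseˡ _)

  signedBinomial-zero : ∀ j → signedBinomial 0 (suc j) + signedBinomial 0 j ≈ 0#
  signedBinomial-zero j = -s*x+s*x≈0 (sgn j) (ι 1)

  -- Pascal's rule. For j ≤ k the sign does not flip (j ∸ k is truncated), but then (j choose k+1) = 0.
  signedBinomial-suc : ∀ k j → signedBinomial (suc k) (suc j) + signedBinomial (suc k) j ≈ signedBinomial k j
  signedBinomial-suc k j with ℕP.≤-<-connex (suc k) j
  ... | inj₁ k<j@(s≤s k≤j-1) = begin
    sgn (j ∸ k) * ι (suc j Comb.C suc k) + s * ι b ≈⟨ +-congʳ (*-cong (reflexive (≡.cong sgn j∸k≡suc))
                                                                        (reflexive (≡.cong ι (≡.sym pascal)))) ⟩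
    - s * ι (a ℕ.+ b) + s * ι b                    ≈⟨ +-congʳ (*-congˡ (ι-+ a b)) ⟩
    - s * (ι a + ι b) + s * ι b                    ≈⟨ +-congʳ (distribˡ _ _ _) ⟩
    (- s * ι a + - s * ι b) + s * ι b              ≈⟨ +-assoc _ _ _ ⟩
    - s * ι a + (- s * ι b + s * ι b)              ≈⟨ +-congˡ (-s*x+s*x≈0 s (ι b)) ⟩
    - s * ι a + 0#                                 ≈⟨ +-identityʳ _ ⟩
    - s * ι a                                      ≈⟨ *-congʳ (reflexive (≡.cong sgn (≡.sym j∸k≡suc))) ⟩
    signedBinomial k j                             ∎
    where
    a = j Comb.C k
    b = j Comb.C suc k
    s = sgn (j ∸ suc k)
    pascal = Comb.nCk+nC[k+1]≡[n+1]C[k+1] j k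
    j∸k≡suc : j ∸ k ≡ suc (j ∸ suc k)
    j∸k≡suc = ℕP.+-∸-assoc 1 k≤j-1
  ... | inj₂ j<k+1 = begin
    sgn (j ∸ k) * ι (suc j Comb.C suc k) + sgn (j ∸ suc k) * ι (j Comb.C suc k)
      ≈⟨ +-cong (*-congˡ (reflexive (≡.cong ι (≡.trans (≡.sym (Comb.nCk+nC[k+1]≡[n+1]C[k+1] j k))
                                                  (≡.trans (≡.cong (j Comb.C k ℕ.+_) (Comb.k>n⇒nCk≡0 j<k+1))
                                                           (ℕP.+-identityʳ _))))))
                (*-congˡ (reflexive (≡.cong ι (Comb.k>n⇒nCk≡0 j<k+1)))) ⟩
    sgn (j ∸ k) * ι (j Comb.C k) + sgn (j ∸ suc k) * 0#
      ≈⟨ ≈-trans (+-congˡ (zeroʳ _)) (+-identityʳ _) ⟩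
    signedBinomial k j
      ∎

  ∑-subsets-signedBinomial : ∀ m (E : Subset m) k →
    ∑ (subsets m) (λ V → ind (V ⊆ᵇ E) * signedBinomial k ∣ V ∣) ≈ ind (∣ E ∣ ==ℕ k)
  ∑-subsets-signedBinomial zero    []          zero    = ≈-trans (+-identityʳ _) (≈-trans (*-identityˡ _) (≈-trans (*-identityˡ _) (+-identityʳ _)))
  ∑-subsets-signedBinomial zero    []          (suc k) = ≈-trans (+-identityʳ _) (≈-trans (*-identityˡ _) (zeroʳ _))
  ∑-subsets-signedBinomial (suc m) (false ∷ E) k = begin
    ∑ (subsets (suc m)) (λ V → ind (V ⊆ᵇ (false ∷ E)) * signedBinomial k ∣ V ∣)
      ≈⟨ ∑-subsets-suc m _ ⟩
    ∑ (subsets m) (λ V → 0# * signedBinomial k (suc ∣ V ∣) + ind (V ⊆ᵇ E) * signedBinomial k ∣ V ∣)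
      ≈⟨ ∑-cong (subsets m) (λ V → ≈-trans (+-congʳ (zeroˡ _)) (+-identityˡ _)) ⟩
    ∑ (subsets m) (λ V → ind (V ⊆ᵇ E) * signedBinomial k ∣ V ∣)
      ≈⟨ ∑-subsets-signedBinomial m E k ⟩
    ind (∣ E ∣ ==ℕ k)
      ∎
  ∑-subsets-signedBinomial (suc m) (true ∷ E) k = begin
    ∑ (subsets (suc m)) (λ V → ind (V ⊆ᵇ (true ∷ E)) * signedBinomial k ∣ V ∣)
      ≈⟨ ∑-subsets-suc m _ ⟩
    ∑ (subsets m) (λ V → ind (V ⊆ᵇ E) * signedBinomial k (suc ∣ V ∣) + ind (V ⊆ᵇ E) * signedBinomial k ∣ V ∣)
      ≈⟨ ∑-cong (subsets m) (λ V → ≈-sym (distribˡ _ _ _)) ⟩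
    ∑ (subsets m) (λ V → ind (V ⊆ᵇ E) * (signedBinomial k (suc ∣ V ∣) + signedBinomial k ∣ V ∣))
      ≈⟨ pairs k ⟩
    ind (suc ∣ E ∣ ==ℕ k)
      ∎
    where
    pairs : ∀ k → ∑ (subsets m) (λ V → ind (V ⊆ᵇ E) * (signedBinomial k (suc ∣ V ∣) + signedBinomial k ∣ V ∣))
                  ≈ ind (suc ∣ E ∣ ==ℕ k)
    pairs zero    = ∑-zero (subsets m) (λ V → ≈-trans (*-congˡ (signedBinomial-zero ∣ V ∣)) (zeroʳ _))
    pairs (suc k) = ≈-trans (∑-cong (subsets m) (λ V → *-congˡ (signedBinomial-suc k ∣ V ∣)))
                            (≈-trans (∑-subsets-signedBinomial m E k) (reflexive (≡.cong ind (≡.sym (==ℕ-suc ∣ E ∣ k)))))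

  module _ (A D : Subset n) (w : Word n) (injw : IsInjective w) (k : ℕ) where

    private
      E = A ∩ preimage w D

      ∑-⊆E : ∑ (subsets n) (λ V → ind (V ⊆ᵇ E) * signedBinomial k ∣ V ∣) ≈ ind (∣ image w A ∩ D ∣ ==ℕ k)
      ∑-⊆E = ≈-trans (∑-subsets-signedBinomial n E k) (reflexive (≡.cong (λ x → ind (x ==ℕ k)) (∣∩preimage∣ w injw A D)))

    ∑∇̃≈δ : Σ𝒜 (subsets n) (λ V → (λ w → ind (V ⊆ᵇ A) * (signedBinomial k ∣ V ∣ * ∇̃ D V w))) w
           ≈ ind (∣ image w A ∩ D ∣ ==ℕ k)
    ∑∇̃≈δ = begin
      Σ𝒜 (subsets n) (λ V → (λ w → ind (V ⊆ᵇ A) * (signedBinomial k ∣ V ∣ * ∇̃ D V w))) w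
        ≡⟨ Σ𝒜-apply (subsets n) _ w ⟩
      ∑ (subsets n) (λ V → ind (V ⊆ᵇ A) * (signedBinomial k ∣ V ∣ * ind (image w V ⊆ᵇ D)))
        ≈⟨ ∑-cong (subsets n) term ⟩
      ∑ (subsets n) (λ V → ind (V ⊆ᵇ E) * signedBinomial k ∣ V ∣)
        ≈⟨ ∑-⊆E ⟩
      ind (∣ image w A ∩ D ∣ ==ℕ k)
        ∎
      where
      term : ∀ V → ind (V ⊆ᵇ A) * (signedBinomial k ∣ V ∣ * ind (image w V ⊆ᵇ D)) ≈ ind (V ⊆ᵇ E) * signedBinomial k ∣ V ∣
      term V = begin
        ind (V ⊆ᵇ A) * (signedBinomial k ∣ V ∣ * ind (image w V ⊆ᵇ D)) ≈⟨ *-congˡ (*-comm _ _) ⟩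
        ind (V ⊆ᵇ A) * (ind (image w V ⊆ᵇ D) * signedBinomial k ∣ V ∣) ≈⟨ *-assoc _ _ _ ⟨
        ind (V ⊆ᵇ A) * ind (image w V ⊆ᵇ D) * signedBinomial k ∣ V ∣   ≈⟨ *-congʳ (ind-∧ _ _) ⟨
        ind ((V ⊆ᵇ A) ∧ (image w V ⊆ᵇ D)) * signedBinomial k ∣ V ∣     ≡⟨ ≡.cong (λ b → ind b * _) (⊆ᵇ-∩-preimage w A D V) ⟩
        ind (V ⊆ᵇ E) * signedBinomial k ∣ V ∣                          ∎

    ∑∇≈δ : Σ𝒜 (subsets n) (λ U → Σ𝒜 (subsets n) (λ V →
             (λ w → ind (admissible A D U V) * (signedBinomial k ∣ U ∣ * ∇ U V w)))) w
           ≈ ind (∣ image w A ∩ D ∣ ==ℕ k)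
    ∑∇≈δ = begin
      Σ𝒜 (subsets n) (λ U → Σ𝒜 (subsets n) (λ V → (λ w → ind (admissible A D U V) * (signedBinomial k ∣ U ∣ * ∇ U V w)))) w
        ≈⟨ ≈-trans (reflexive (Σ𝒜-apply (subsets n) _ w)) (∑-cong (subsets n) (λ U → reflexive (Σ𝒜-apply (subsets n) _ w))) ⟩
      ∑ (subsets n) (λ U → ∑ (subsets n) (λ V → ind (admissible A D U V) * (signedBinomial k ∣ U ∣ * ind (image w V ==S U))))
        ≈⟨ ∑-swap (subsets n) (subsets n) _ ⟩
      ∑ (subsets n) (λ V → ∑ (subsets n) (λ U → ind (admissible A D U V) * (signedBinomial k ∣ U ∣ * ind (image w V ==S U))))
        ≈⟨ ∑-cong (subsets n) (λ V → ∑-cong (subsets n) (λ U → ≈-trans (*-congˡ (*-comm _ _)) (*-x∙yz≈y∙xz _ _ _))) ⟩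
      ∑ (subsets n) (λ V → ∑ (subsets n) (λ U → ind (image w V ==S U) * (ind (admissible A D U V) * signedBinomial k ∣ U ∣)))
        ≈⟨ ∑-cong (subsets n) (λ V → ∑-subsets-δ n (image w V) (λ U → ind (admissible A D U V) * signedBinomial k ∣ U ∣)) ⟩
      ∑ (subsets n) (λ V → ind (admissible A D (image w V) V) * signedBinomial k ∣ image w V ∣)
        ≈⟨ ∑-cong (subsets n) (λ V → reflexive (cong₂ (λ b j → ind b * signedBinomial k j) (admissible-image w injw A D V) (∣image∣ w injw V))) ⟩
      ∑ (subsets n) (λ V → ind (V ⊆ᵇ E) * signedBinomial k ∣ V ∣)
        ≈⟨ ∑-⊆E ⟩
      ind (∣ image w A ∩ D ∣ ==ℕ k)
        ∎

theorem1p2p2 : ∀ {c ℓ} (R : CommutativeRing c ℓ) (n : ℕ) (A B C D : Subset n) →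
  ∣ A ∣ ≡ ∣ B ∣ → ∣ C ∣ ≡ ∣ D ∣ →
  let open CommutativeRing R using (_*_) in
  let open GroupAlgebra R n in
  let k = ∣ B ∩ C ∣ in
  ((∇ D C ⊛ ∇ B A) ≋ (ι (ω B C) · (λ w → ind (∣ image w A ∩ D ∣ ==ℕ k))))
  × ((∇ D C ⊛ ∇ B A) ≋ (ι (ω B C) · Σ𝒜 (subsets n) (λ U → Σ𝒜 (subsets n) (λ V →
        (λ w → ind ((U ⊆ᵇ D) ∧ (V ⊆ᵇ A) ∧ (∣ U ∣ ==ℕ ∣ V ∣))
                 * (sgn (∣ U ∣ ∸ k) * ι (∣ U ∣ Comb.C k) * ∇ U V w))))))
  × ((∇ D C ⊛ ∇ B A) ≋ (ι (ω B C) · Σ𝒜 (subsets n) (λ V →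
        (λ w → ind (V ⊆ᵇ A) * (sgn (∣ V ∣ ∸ k) * ι (∣ V ∣ Comb.C k) * ∇̃ D V w)))))
theorem1p2p2 R n A B C D ∣A∣≡∣B∣ ∣C∣≡∣D∣ =
  (λ w perm → part-a w perm) ,
  (λ w perm → trans (part-a w perm) (*-congˡ (sym (∑∇≈δ R n A D w (isInjective⁻ w perm) k)))) ,
  (λ w perm → trans (part-a w perm) (*-congˡ (sym (∑∇̃≈δ R n A D w (isInjective⁻ w perm) k))))
  where
  open CommutativeRing R using (sym; trans; *-congˡ)
  k = ∣ B ∩ C ∣
  part-a = λ w perm → ∇⊛∇≈ω·δ R n A B C D w (isInjective⁻ w perm) ∣A∣≡∣B∣ ∣C∣≡∣D∣
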